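{- Let $g:\mathbb{R}\to\mathbb{R}$ be a $\mathbb{Z}$-convex function with minimum at $0$, let $p\in\mathbb{Z}$ and let $k\in\mathbb{Z}$ with $k\ge |p|$. Consider \[ \min\Big\{\sum_{j=1}^k (g(j)-g(j-1))x_j+(g(-j)-g(-j+1))y_j:\ p=\sum_{j=1}^k x_j-\sum_{j=1}^k y_j,\ x_j,y_j\in\{0,1\},\ j=1,\ldots,k\Big\}. \] An optimal solution is given by: $x_1=\cdots=x_p=1$, $x_{p+1}=\cdots=x_k=y_1=\cdots=y_k=0$ if $p>0$; all $x_j=y_j=0$ if $p=0$; $y_1=\cdots=y_{ -p}=1$, $y_{ -p+1}=\cdots=y_k=x_1=\cdots=x_k=0$ if $p<0$. In each case the optimal value is $g(p)-g(0)$.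
   Context: A function $g:\mathbb{R}\to\mathbb{R}$ is called $\mathbb{Z}$-convex with minimum at $0$ if the function $x\mapsto g(x+1)-g(x)$ is increasing (non-decreasing) on $\mathbb{Z}$, $g(x+1)-g(x)\le 0$ for all integers $x<0$, and $g(x+1)-g(x)\ge 0$ for all integers $x\ge 0$. -}

module Defs where

open import Level using (Level; _⊔_) renaming (suc to lsuc)
open import Data.Bool using (Bool; true; false; if_then_else_)
open import Data.Nat as ℕ using (ℕ; zero; suc; _≤ᵇ_)
open import Data.Integer as ℤ using (ℤ; +_; -[1+_]; ∣_∣)
open import Algebra.Bundles using (AbelianGroup)
open import Relation.Binary.Core using (Rel)
open import Relation.Binary.Structures using (IsTotalOrder)
open import Relation.Binary.PropositionalEquality using (_≡_)

-- A totally ordered abelian group (the codomain ℝ of g is an instance;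
-- only +, -, 0 and ≤ on the values of g are used by the statement).
record TotallyOrderedAbelianGroup (c ℓ₁ ℓ₂ : Level) : Set (lsuc (c ⊔ ℓ₁ ⊔ ℓ₂)) where
  field
    abelianGroup : AbelianGroup c ℓ₁
  open AbelianGroup abelianGroup public
  infix 4 _≤_
  field
    _≤_          : Rel Carrier ℓ₂
    isTotalOrder : IsTotalOrder _≈_ _≤_
    ∙-monoˡ-≤    : ∀ z {x y} → x ≤ y → (x ∙ z) ≤ (y ∙ z)

module _ {c ℓ₁ ℓ₂} (G : TotallyOrderedAbelianGroup c ℓ₁ ℓ₂) where
  open TotallyOrderedAbelianGroup G

  Δ : (ℤ → Carrier) → ℤ → Carrier
  Δ g x = g (x ℤ.+ ℤ.1ℤ) - g x

  -- ℤ-convex with minimum at 0 (g only matters on ℤ)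
  record ZConvexMin0 (g : ℤ → Carrier) : Set (ℓ₂) where
    field
      Δ-mono : ∀ x y → x ℤ.≤ y → Δ g x ≤ Δ g y
      Δ-neg  : ∀ x → x ℤ.< ℤ.0ℤ → Δ g x ≤ ε
      Δ-pos  : ∀ x → ℤ.0ℤ ℤ.≤ x → ε ≤ Δ g x

  Σ₁ : (ℕ → Carrier) → ℕ → Carrier
  Σ₁ f zero    = ε
  Σ₁ f (suc k) = Σ₁ f k ∙ f (suc k)

  scale : Bool → Carrier → Carrier
  scale b a = if b then a else ε

  objective : (ℤ → Carrier) → ℕ → (ℕ → Bool) → (ℕ → Bool) → Carrier
  objective g k x y =
    Σ₁ (λ j → scale (x j) (g (+ j) - g (+ j ℤ.- ℤ.1ℤ))
            ∙ scale (y j) (g (ℤ.- (+ j)) - g (ℤ.- (+ j) ℤ.+ ℤ.1ℤ))) k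

Σℕ : (ℕ → ℕ) → ℕ → ℕ
Σℕ f zero    = 0
Σℕ f (suc k) = Σℕ f k ℕ.+ f (suc k)

bit : Bool → ℕ
bit true  = 1
bit false = 0

Feasible : ℤ → ℕ → (ℕ → Bool) → (ℕ → Bool) → Set
Feasible p k x y = p ≡ (+ Σℕ (λ j → bit (x j)) k) ℤ.- (+ Σℕ (λ j → bit (y j)) k)

xOpt : ℤ → ℕ → Bool
xOpt (+ n)     j = j ≤ᵇ n
xOpt -[1+ n ]  j = false

yOpt : ℤ → ℕ → Bool
yOpt (+ n)     j = false
yOpt -[1+ n ]  j = j ≤ᵇ suc n

-- Write Δ⁺ j = g(j) − g(j−1) and Δ⁻ j = g(−j) − g(−j+1); the objective adds up the
-- Δ⁺ j with x j set and the Δ⁻ j with y j set. Z-convexity with minimum at 0 makes both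
-- sequences nondecreasing, and nonnegative from j = 1 on, and they telescope:
-- Δ⁺ 1 + … + Δ⁺ n = g(n) − g(0) and Δ⁻ 1 + … + Δ⁻ n = g(−n) − g(0). For p ≥ 0 a feasible x
-- selects at least p indices in 1..k; since Δ⁺ is nondecreasing, the i-th selected index
-- is at least i, so the selected Δ⁺-terms sum to at least Δ⁺ 1 + … + Δ⁺ p = g(p) − g(0),
-- while the Δ⁻-terms add something nonnegative. The case p < 0 is symmetric, and the
-- proposed solution attains the bound.

{-# OPTIONS --safe #-}
module Submission where

open import Defs
open import Data.Bool using (Bool; true; false)
open import Data.Nat using (ℕ; zero; suc; _≤ᵇ_; _⊓_)
open import Data.Integer using (ℤ; ∣_∣; 0ℤ; +_; -[1+_])
open import Data.Product using (_×_; _,_)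
open import Data.Sum using (inj₁; inj₂)
import Data.Nat as ℕ
import Data.Nat.Properties as ℕ
import Data.Integer as ℤ
import Data.Integer.Properties as ℤ
open import Relation.Binary.Core using (_Preserves_⟶_)
open import Relation.Binary.Bundles using (Poset)
open import Relation.Binary.Structures using (IsTotalOrder)
open import Relation.Binary.PropositionalEquality as ≡ using (_≡_)
open import Relation.Nullary.Reflects using (ofʸ; ofⁿ)

count : (ℕ → Bool) → ℕ → ℕ
count x = Σℕ (λ j → bit (x j))

count≤ : ∀ x k → count x k ℕ.≤ k
count≤ x zero = ℕ.z≤n
count≤ x (suc k) with x (suc k)
... | true  = ≡.subst (ℕ._≤ suc k) (ℕ.+-comm 1 (count x k)) (ℕ.s≤s (count≤ x k))
... | false = ≡.subst (ℕ._≤ suc k) (≡.sym (ℕ.+-identityʳ (count x k))) (ℕ.m≤n⇒m≤1+n (count≤ x k))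

count-none : ∀ k → count (λ _ → false) k ≡ 0
count-none zero    = ≡.refl
count-none (suc k) = ≡.cong (ℕ._+ 0) (count-none k)

count-prefix : ∀ n k → count (_≤ᵇ n) k ≡ k ⊓ n
count-prefix n zero = ≡.refl
count-prefix n (suc k) with suc k ≤ᵇ n | ℕ.≤ᵇ-reflects-≤ (suc k) n
... | true  | ofʸ k<n
  rewrite count-prefix n k | ℕ.m≤n⇒m⊓n≡m (ℕ.<⇒≤ k<n) | ℕ.m≤n⇒m⊓n≡m k<n = ℕ.+-comm k 1
... | false | ofⁿ k≮n
  rewrite count-prefix n k | ℕ.m≥n⇒m⊓n≡n (ℕ.≮⇒≥ k≮n) | ℕ.m≥n⇒m⊓n≡n (ℕ.≰⇒≥ k≮n) = ℕ.+-identityʳ n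

Feasible⇒p≤count : ∀ {p} k x y → Feasible p k x y → p ℤ.≤ + count x k
Feasible⇒p≤count k x y ≡.refl = ℤ.i-j≤i (+ count x k) (+ count y k)

Feasible⇒-count≤p : ∀ {p} k x y → Feasible p k x y → ℤ.- + count y k ℤ.≤ p
Feasible⇒-count≤p k x y ≡.refl = ℤ.i≤j+i (ℤ.- + count y k) (+ count x k)

Feasible-xOpt-yOpt : ∀ {p k} → ∣ p ∣ ℕ.≤ k → Feasible p k (xOpt p) (yOpt p)
Feasible-xOpt-yOpt {+ n} {k} n≤k
  rewrite count-prefix n k | ℕ.m≥n⇒m⊓n≡n n≤k | count-none k = ≡.sym (ℤ.+-identityʳ (+ n))
Feasible-xOpt-yOpt { -[1+ n ]} {k} n<k
  rewrite count-prefix (suc n) k | ℕ.m≥n⇒m⊓n≡n n<k | count-none k = ≡.refl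

module _ {c ℓ₁ ℓ₂} (G : TotallyOrderedAbelianGroup c ℓ₁ ℓ₂) where
  open TotallyOrderedAbelianGroup G
  open import Algebra.Properties.AbelianGroup abelianGroup using (⁻¹-anti-homo‿-; ε⁻¹≈ε; //-rightDividesˡ)

  poset : Poset c ℓ₁ ℓ₂
  poset = record { isPartialOrder = IsTotalOrder.isPartialOrder isTotalOrder }

  open Poset poset using () renaming (refl to ≤-refl)
  open import Relation.Binary.Reasoning.PartialOrder poset

  ∙-monoʳ-≤ : ∀ z {x y} → x ≤ y → z ∙ x ≤ z ∙ y
  ∙-monoʳ-≤ z {x} {y} x≤y = begin
    z ∙ x ≈⟨ comm z x ⟩
    x ∙ z ≤⟨ ∙-monoˡ-≤ z x≤y ⟩
    y ∙ z ≈⟨ comm y z ⟩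
    z ∙ y ∎

  ∙-mono-≤ : ∀ {x x′ y y′} → x ≤ x′ → y ≤ y′ → x ∙ y ≤ x′ ∙ y′
  ∙-mono-≤ {x} {x′} {y} {y′} x≤x′ y≤y′ = begin
    x ∙ y    ≤⟨ ∙-monoˡ-≤ y x≤x′ ⟩
    x′ ∙ y   ≤⟨ ∙-monoʳ-≤ x′ y≤y′ ⟩
    x′ ∙ y′  ∎

  ⁻¹-antitone : ∀ {x y} → x ≤ y → y ⁻¹ ≤ x ⁻¹
  ⁻¹-antitone {x} {y} x≤y = begin
    y ⁻¹               ≈⟨ //-rightDividesˡ x (y ⁻¹) ⟨
    y ⁻¹ ∙ x ⁻¹ ∙ x    ≈⟨ comm _ x ⟩
    x ∙ (y ⁻¹ ∙ x ⁻¹)  ≤⟨ ∙-monoˡ-≤ (y ⁻¹ ∙ x ⁻¹) x≤y ⟩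
    y ∙ (y ⁻¹ ∙ x ⁻¹)  ≈⟨ assoc y (y ⁻¹) (x ⁻¹) ⟨
    y ∙ y ⁻¹ ∙ x ⁻¹    ≈⟨ ∙-congʳ (inverseʳ y) ⟩
    ε ∙ x ⁻¹           ≈⟨ identityˡ (x ⁻¹) ⟩
    x ⁻¹               ∎

  x≤x∙y : ∀ x {y} → ε ≤ y → x ≤ x ∙ y
  x≤x∙y x {y} y≥0 = begin
    x      ≈⟨ identityʳ x ⟨
    x ∙ ε  ≤⟨ ∙-monoʳ-≤ x y≥0 ⟩
    x ∙ y  ∎

  y≤x∙y : ∀ {x} y → ε ≤ x → y ≤ x ∙ y
  y≤x∙y {x} y x≥0 = begin
    y      ≈⟨ identityˡ y ⟨
    ε ∙ y  ≤⟨ ∙-monoˡ-≤ y x≥0 ⟩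
    x ∙ y  ∎

  Σ₁-∙ : ∀ f h k → Σ₁ G (λ j → f j ∙ h j) k ≈ Σ₁ G f k ∙ Σ₁ G h k
  Σ₁-∙ f h zero    = sym (identityˡ ε)
  Σ₁-∙ f h (suc k) = trans (∙-congʳ (Σ₁-∙ f h k)) (interchange _ _ _ _)
    where open import Algebra.Properties.CommutativeSemigroup commutativeSemigroup using (interchange)

  Σ₁-nonneg : ∀ {f} → (∀ j → ε ≤ f (suc j)) → ∀ k → ε ≤ Σ₁ G f k
  Σ₁-nonneg f≥0 zero    = ≤-refl
  Σ₁-nonneg {f} f≥0 (suc k) = begin
    ε                     ≈⟨ identityʳ ε ⟨
    ε ∙ ε                 ≤⟨ ∙-mono-≤ (Σ₁-nonneg f≥0 k) (f≥0 k) ⟩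
    Σ₁ G f k ∙ f (suc k)  ∎

  Σ₁-monoʳ-≤ : ∀ {f} → (∀ j → ε ≤ f (suc j)) → ∀ {m n} → m ℕ.≤ n → Σ₁ G f m ≤ Σ₁ G f n
  Σ₁-monoʳ-≤ f≥0 {n = zero} ℕ.z≤n = ≤-refl
  Σ₁-monoʳ-≤ {f} f≥0 {m} {suc n} m≤1+n with ℕ.m≤n⇒m<n∨m≡n m≤1+n
  ... | inj₂ ≡.refl = ≤-refl
  ... | inj₁ m<1+n = begin
    Σ₁ G f m              ≈⟨ identityʳ _ ⟨
    Σ₁ G f m ∙ ε          ≤⟨ ∙-mono-≤ (Σ₁-monoʳ-≤ f≥0 (ℕ.s≤s⁻¹ m<1+n)) (f≥0 n) ⟩
    Σ₁ G f n ∙ f (suc n)  ∎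

  Σ₁-telescope : ∀ {f} (h : ℕ → Carrier) → (∀ j → f (suc j) ≈ h (suc j) - h j) →
                 ∀ n → Σ₁ G f n ≈ h n - h 0
  Σ₁-telescope h f≈Δh zero    = sym (inverseʳ (h 0))
  Σ₁-telescope {f} h f≈Δh (suc n) = begin-equality
    Σ₁ G f n ∙ f (suc n)                       ≈⟨ ∙-cong (Σ₁-telescope h f≈Δh n) (f≈Δh n) ⟩
    (h n - h 0) ∙ (h (suc n) - h n)            ≈⟨ comm _ _ ⟩
    (h (suc n) - h n) ∙ (h n - h 0)            ≈⟨ assoc _ _ _ ⟨
    (h (suc n) - h n) ∙ h n - h 0              ≈⟨ ∙-congʳ (//-rightDividesˡ (h n) (h (suc n))) ⟩
    h (suc n) - h 0                            ∎

  selected : (ℕ → Bool) → (ℕ → Carrier) → ℕ → Carrier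
  selected x f = Σ₁ G (λ j → scale G (x j) (f j))

  selected-nonneg : ∀ {f} → (∀ j → ε ≤ f (suc j)) → ∀ x k → ε ≤ selected x f k
  selected-nonneg {f} f≥0 x = Σ₁-nonneg scaled≥0
    where
    scaled≥0 : ∀ j → ε ≤ scale G (x (suc j)) (f (suc j))
    scaled≥0 j with x (suc j)
    ... | true  = f≥0 j
    ... | false = ≤-refl

  Σ₁-count≤selected : ∀ {f} → f Preserves ℕ._≤_ ⟶ _≤_ →
                      ∀ x k → Σ₁ G f (count x k) ≤ selected x f k
  Σ₁-count≤selected f-mono x zero = ≤-refl
  Σ₁-count≤selected {f} f-mono x (suc k) with x (suc k)
  ... | true  = begin
    Σ₁ G f (count x k ℕ.+ 1)  ≡⟨ ≡.cong (Σ₁ G f) (ℕ.+-comm (count x k) 1) ⟩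
    Σ₁ G f (count x k) ∙ f (suc (count x k))
      ≤⟨ ∙-mono-≤ (Σ₁-count≤selected f-mono x k) (f-mono (ℕ.s≤s (count≤ x k))) ⟩
    selected x f k ∙ f (suc k)  ∎
  ... | false = begin
    Σ₁ G f (count x k ℕ.+ 0)  ≡⟨ ≡.cong (Σ₁ G f) (ℕ.+-identityʳ (count x k)) ⟩
    Σ₁ G f (count x k)        ≤⟨ Σ₁-count≤selected f-mono x k ⟩
    selected x f k            ≈⟨ identityʳ _ ⟨
    selected x f k ∙ ε        ∎

  Σ₁≤selected : ∀ {f} → f Preserves ℕ._≤_ ⟶ _≤_ → (∀ j → ε ≤ f (suc j)) →
                ∀ {n} x k → n ℕ.≤ count x k → Σ₁ G f n ≤ selected x f k
  Σ₁≤selected {f} f-mono f≥0 {n} x k n≤count = begin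
    Σ₁ G f n            ≤⟨ Σ₁-monoʳ-≤ f≥0 n≤count ⟩
    Σ₁ G f (count x k)  ≤⟨ Σ₁-count≤selected f-mono x k ⟩
    selected x f k      ∎

  selected-none : ∀ f k → selected (λ _ → false) f k ≈ ε
  selected-none f zero    = refl
  selected-none f (suc k) = trans (identityʳ _) (selected-none f k)

  selected-prefix : ∀ f n k → selected (_≤ᵇ n) f k ≈ Σ₁ G f (k ⊓ n)
  selected-prefix f n zero = refl
  selected-prefix f n (suc k) with suc k ≤ᵇ n | ℕ.≤ᵇ-reflects-≤ (suc k) n
  ... | true  | ofʸ k<n = begin-equality
    selected (_≤ᵇ n) f k ∙ f (suc k)  ≈⟨ ∙-congʳ (selected-prefix f n k) ⟩
    Σ₁ G f (k ⊓ n) ∙ f (suc k)        ≡⟨ ≡.cong (λ i → Σ₁ G f i ∙ f (suc k)) (ℕ.m≤n⇒m⊓n≡m (ℕ.<⇒≤ k<n)) ⟩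
    Σ₁ G f (suc k)                    ≡⟨ ≡.cong (Σ₁ G f) (ℕ.m≤n⇒m⊓n≡m k<n) ⟨
    Σ₁ G f (suc k ⊓ n)                ∎
  ... | false | ofⁿ k≮n = begin-equality
    selected (_≤ᵇ n) f k ∙ ε  ≈⟨ identityʳ _ ⟩
    selected (_≤ᵇ n) f k      ≈⟨ selected-prefix f n k ⟩
    Σ₁ G f (k ⊓ n)            ≡⟨ ≡.cong (Σ₁ G f) (ℕ.m≥n⇒m⊓n≡n (ℕ.≮⇒≥ k≮n)) ⟩
    Σ₁ G f n                  ≡⟨ ≡.cong (Σ₁ G f) (ℕ.m≥n⇒m⊓n≡n (ℕ.≰⇒≥ k≮n)) ⟨
    Σ₁ G f (suc k ⊓ n)        ∎

  module _ (g : ℤ → Carrier) where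

    g-cong : ∀ {i j} → i ≡ j → g i ≈ g j
    g-cong i≡j = reflexive (≡.cong g i≡j)

    Δ⁺ Δ⁻ : ℕ → Carrier
    Δ⁺ j = g (+ j) - g (+ j ℤ.- ℤ.1ℤ)
    Δ⁻ j = g (ℤ.- + j) - g (ℤ.- + j ℤ.+ ℤ.1ℤ)

    Δ⁺≈Δ : ∀ j → Δ⁺ j ≈ Δ G g (+ j ℤ.- ℤ.1ℤ)
    Δ⁺≈Δ j = ∙-congʳ (g-cong (≡.sym i-1+1≡i))
      where
      i-1+1≡i : (+ j ℤ.- ℤ.1ℤ) ℤ.+ ℤ.1ℤ ≡ + j
      i-1+1≡i = ≡.trans (ℤ.+-assoc (+ j) ℤ.-1ℤ ℤ.1ℤ) (ℤ.+-identityʳ (+ j))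

    Δ⁻≈Δ⁻¹ : ∀ j → Δ⁻ j ≈ Δ G g (ℤ.- + j) ⁻¹
    Δ⁻≈Δ⁻¹ j = sym (⁻¹-anti-homo‿- _ _)

    Σ₁-Δ⁺ : ∀ n → Σ₁ G Δ⁺ n ≈ g (+ n) - g 0ℤ
    Σ₁-Δ⁺ = Σ₁-telescope (λ m → g (+ m)) (λ _ → refl)

    Σ₁-Δ⁻ : ∀ n → Σ₁ G Δ⁻ n ≈ g (ℤ.- + n) - g 0ℤ
    Σ₁-Δ⁻ = Σ₁-telescope (λ m → g (ℤ.- + m)) (λ j → ∙-congˡ (⁻¹-cong (g-cong (ℤ.1-[1+n]≡-n j))))

    objective≈selected∙selected : ∀ k x y → objective G g k x y ≈ selected x Δ⁺ k ∙ selected y Δ⁻ k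
    objective≈selected∙selected k x y = Σ₁-∙ _ _ k

    objective-xOpt-yOpt≈g[p]-g[0] : ∀ {p k} → ∣ p ∣ ℕ.≤ k →
                                    objective G g k (xOpt p) (yOpt p) ≈ g p - g 0ℤ
    objective-xOpt-yOpt≈g[p]-g[0] {+ n} {k} n≤k = begin-equality
      objective G g k (xOpt (+ n)) (yOpt (+ n))
        ≈⟨ objective≈selected∙selected k (xOpt (+ n)) (yOpt (+ n)) ⟩
      selected (_≤ᵇ n) Δ⁺ k ∙ selected (λ _ → false) Δ⁻ k
        ≈⟨ ∙-cong (selected-prefix Δ⁺ n k) (selected-none Δ⁻ k) ⟩
      Σ₁ G Δ⁺ (k ⊓ n) ∙ ε  ≈⟨ identityʳ _ ⟩
      Σ₁ G Δ⁺ (k ⊓ n)      ≡⟨ ≡.cong (Σ₁ G Δ⁺) (ℕ.m≥n⇒m⊓n≡n n≤k) ⟩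
      Σ₁ G Δ⁺ n            ≈⟨ Σ₁-Δ⁺ n ⟩
      g (+ n) - g 0ℤ       ∎
    objective-xOpt-yOpt≈g[p]-g[0] { -[1+ n ]} {k} n<k = begin-equality
      objective G g k (xOpt -[1+ n ]) (yOpt -[1+ n ])
        ≈⟨ objective≈selected∙selected k (xOpt -[1+ n ]) (yOpt -[1+ n ]) ⟩
      selected (λ _ → false) Δ⁺ k ∙ selected (_≤ᵇ suc n) Δ⁻ k
        ≈⟨ ∙-cong (selected-none Δ⁺ k) (selected-prefix Δ⁻ (suc n) k) ⟩
      ε ∙ Σ₁ G Δ⁻ (k ⊓ suc n)  ≈⟨ identityˡ _ ⟩
      Σ₁ G Δ⁻ (k ⊓ suc n)      ≡⟨ ≡.cong (Σ₁ G Δ⁻) (ℕ.m≥n⇒m⊓n≡n n<k) ⟩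
      Σ₁ G Δ⁻ (suc n)          ≈⟨ Σ₁-Δ⁻ (suc n) ⟩
      g -[1+ n ] - g 0ℤ        ∎

  module _ {g : ℤ → Carrier} (zc : ZConvexMin0 G g) where
    open ZConvexMin0 zc

    Δ⁺-mono : Δ⁺ g Preserves ℕ._≤_ ⟶ _≤_
    Δ⁺-mono {i} {j} i≤j = begin
      Δ⁺ g i                   ≈⟨ Δ⁺≈Δ g i ⟩
      Δ G g (+ i ℤ.- ℤ.1ℤ)     ≤⟨ Δ-mono _ _ (ℤ.+-monoˡ-≤ ℤ.-1ℤ (ℤ.+≤+ i≤j)) ⟩
      Δ G g (+ j ℤ.- ℤ.1ℤ)     ≈⟨ Δ⁺≈Δ g j ⟨
      Δ⁺ g j                   ∎

    Δ⁻-mono : Δ⁻ g Preserves ℕ._≤_ ⟶ _≤_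
    Δ⁻-mono {i} {j} i≤j = begin
      Δ⁻ g i                   ≈⟨ Δ⁻≈Δ⁻¹ g i ⟩
      Δ G g (ℤ.- + i) ⁻¹       ≤⟨ ⁻¹-antitone (Δ-mono _ _ (ℤ.neg-mono-≤ (ℤ.+≤+ i≤j))) ⟩
      Δ G g (ℤ.- + j) ⁻¹       ≈⟨ Δ⁻≈Δ⁻¹ g j ⟨
      Δ⁻ g j                   ∎

    Δ⁺-nonneg : ∀ j → ε ≤ Δ⁺ g (suc j)
    Δ⁺-nonneg j = begin
      ε               ≤⟨ Δ-pos (+ j) (ℤ.+≤+ ℕ.z≤n) ⟩
      Δ G g (+ j)     ≈⟨ Δ⁺≈Δ g (suc j) ⟨
      Δ⁺ g (suc j)    ∎

    Δ⁻-nonneg : ∀ j → ε ≤ Δ⁻ g (suc j)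
    Δ⁻-nonneg j = begin
      ε                   ≈⟨ ε⁻¹≈ε ⟨
      ε ⁻¹                ≤⟨ ⁻¹-antitone (Δ-neg -[1+ j ] ℤ.-<+) ⟩
      Δ G g -[1+ j ] ⁻¹   ≈⟨ Δ⁻≈Δ⁻¹ g (suc j) ⟨
      Δ⁻ g (suc j)        ∎

    g[p]-g[0]≤objective : ∀ {p} k x y → Feasible p k x y → g p - g 0ℤ ≤ objective G g k x y
    g[p]-g[0]≤objective {+ n} k x y feas = begin
      g (+ n) - g 0ℤ                             ≈⟨ Σ₁-Δ⁺ g n ⟨
      Σ₁ G (Δ⁺ g) n                              ≤⟨ Σ₁≤selected Δ⁺-mono Δ⁺-nonneg x k n≤count ⟩
      selected x (Δ⁺ g) k                        ≤⟨ x≤x∙y _ (selected-nonneg Δ⁻-nonneg y k) ⟩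
      selected x (Δ⁺ g) k ∙ selected y (Δ⁻ g) k  ≈⟨ objective≈selected∙selected g k x y ⟨
      objective G g k x y                        ∎
      where
      n≤count : n ℕ.≤ count x k
      n≤count = ℤ.drop‿+≤+ (Feasible⇒p≤count k x y feas)
    g[p]-g[0]≤objective { -[1+ n ]} k x y feas = begin
      g -[1+ n ] - g 0ℤ                          ≈⟨ Σ₁-Δ⁻ g (suc n) ⟨
      Σ₁ G (Δ⁻ g) (suc n)                        ≤⟨ Σ₁≤selected Δ⁻-mono Δ⁻-nonneg y k 1+n≤count ⟩
      selected y (Δ⁻ g) k                        ≤⟨ y≤x∙y _ (selected-nonneg Δ⁺-nonneg x k) ⟩
      selected x (Δ⁺ g) k ∙ selected y (Δ⁻ g) k  ≈⟨ objective≈selected∙selected g k x y ⟨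
      objective G g k x y                        ∎
      where
      1+n≤count : suc n ℕ.≤ count y k
      1+n≤count = ℤ.drop‿+≤+ (ℤ.neg-cancel-≤ (Feasible⇒-count≤p k x y feas))

lemma3p5 : ∀ {c ℓ₁ ℓ₂} (G : TotallyOrderedAbelianGroup c ℓ₁ ℓ₂) →
    let open TotallyOrderedAbelianGroup G in
    (g : ℤ → Carrier) → ZConvexMin0 G g →
    (p : ℤ) (k : ℕ) → ∣ p ∣ ℕ.≤ k →
    Feasible p k (xOpt p) (yOpt p)
    × (∀ (x y : ℕ → Bool) → Feasible p k x y →
         objective G g k (xOpt p) (yOpt p) ≤ objective G g k x y)
    × (objective G g k (xOpt p) (yOpt p) ≈ g p - g 0ℤ)
lemma3p5 G g zc p k ∣p∣≤k = Feasible-xOpt-yOpt ∣p∣≤k , optimal , value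
  where
  open TotallyOrderedAbelianGroup G
  open import Relation.Binary.Reasoning.PartialOrder (poset G)

  value : objective G g k (xOpt p) (yOpt p) ≈ g p - g 0ℤ
  value = objective-xOpt-yOpt≈g[p]-g[0] G g ∣p∣≤k

  optimal : ∀ x y → Feasible p k x y → objective G g k (xOpt p) (yOpt p) ≤ objective G g k x y
  optimal x y feas = begin
    objective G g k (xOpt p) (yOpt p)  ≈⟨ value ⟩
    g p - g 0ℤ                         ≤⟨ g[p]-g[0]≤objective G zc k x y feas ⟩
    objective G g k x y                ∎
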